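{- Let $n$ and $p$ be positive integers with $n\ge p+5$ and let $G$ be a simple graph of order $n$. If $\overline{G}$ has a connected component which is a cycle of length at least $4$, then $G$ contains $B_p$ as a subgraph.
   Context: The book $B_p$ is the graph consisting of $p$ triangles sharing a common edge. $\overline{G}$ denotes the complement of $G$. -}

module Defs where

open import Data.Nat using (ℕ; suc; _%_; _≡ᵇ_)
open import Data.Bool using (Bool; true; false; not; _∧_; _∨_)
open import Data.Fin using (Fin; toℕ; _≟_)
open import Data.Product using (Σ; _×_; _,_)
open import Function.Definitions using (Injective)
open import Relation.Binary.PropositionalEquality using (_≡_; _≢_; refl; cong; cong₂; trans) renaming (sym to ≡-sym)
open import Relation.Nullary using (yes; no)
open import Data.Empty using (⊥-elim)
open import Relation.Nullary.Decidable using (⌊_⌋)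
open import Data.Bool.Properties using (∧-comm)

record SimpleGraph (n : ℕ) : Set where
  field
    adj    : Fin n → Fin n → Bool
    sym    : ∀ u v → adj u v ≡ adj v u
    irrefl : ∀ v → adj v v ≡ false
open SimpleGraph public

private
  ≟-sym : ∀ {n} (u v : Fin n) → ⌊ u ≟ v ⌋ ≡ ⌊ v ≟ u ⌋
  ≟-sym u v with u ≟ v | v ≟ u
  ... | yes _ | yes _ = refl
  ... | no _  | no _  = refl
  ... | yes p | no q  = ⊥-elim (q (≡-sym p))
  ... | no q  | yes p = ⊥-elim (q (≡-sym p))

  ≟-refl : ∀ {n} (v : Fin n) → ⌊ v ≟ v ⌋ ≡ true
  ≟-refl v with v ≟ v
  ... | yes _ = refl
  ... | no q  = ⊥-elim (q refl)

complement : ∀ {n} → SimpleGraph n → SimpleGraph n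
complement G = record
  { adj    = λ u v → not (adj G u v) ∧ not ⌊ u ≟ v ⌋
  ; sym    = λ u v → cong₂ (λ a b → not a ∧ not b) (sym G u v) (≟-sym u v)
  ; irrefl = λ v → trans
               (cong (λ b → not (adj G v v) ∧ not b) (≟-refl v)) (∧-comm _ false)
  }

cycleAdj : (m : ℕ) → Fin (suc m) → Fin (suc m) → Bool
cycleAdj m i j = (toℕ j ≡ᵇ (suc (toℕ i) % suc m)) ∨ (toℕ i ≡ᵇ (suc (toℕ j) % suc m))

-- H has a connected component that is a cycle of length m + 4 (i.e. length ≥ 4):
-- an injective labelling c : Fin (m+4) → Fin n of its vertices such that the subgraph
-- of H induced on them is exactly the cycle C_{m+4}, and no edge of H leaves this set.
HasCycleComponent : ∀ {n} → SimpleGraph n → (m : ℕ) → Set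
HasCycleComponent {n} H m =
  Σ (Fin (suc (suc (suc (suc m)))) → Fin n) λ c →
    Injective _≡_ _≡_ c
    × (∀ i j → adj H (c i) (c j) ≡ cycleAdj (suc (suc (suc m))) i j)
    × (∀ i v → (∀ j → v ≢ c j) → adj H (c i) v ≡ false)

-- G contains the book B_p as a (not necessarily induced) subgraph: distinct spine
-- vertices u, v that are adjacent, and p distinct pages w_1..w_p, different from u and v,
-- each adjacent to both u and v.
ContainsBook : ∀ {n} → SimpleGraph n → (p : ℕ) → Set
ContainsBook {n} G p =
  Σ (Fin n) λ u → Σ (Fin n) λ v → Σ (Fin p → Fin n) λ w →
    u ≢ v × adj G u v ≡ true × Injective _≡_ _≡_ w
    × (∀ i → w i ≢ u × w i ≢ v × adj G u (w i) ≡ true × adj G v (w i) ≡ true)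

-- The cycle component c₀ c₁ … c_K (K ≥ 3) of the complement is closed, so in the
-- complement c₀ is adjacent only to c₁ and c_K, and c₂ only to c₁ and c₃. Hence c₀c₂ is
-- an edge of G, and every vertex outside B = {c_K, c₀, c₁, c₂, c₃} is adjacent in G to
-- both of them; these are at least n − 5 ≥ p pages.
module Submission where

open import Defs
open import Data.Nat using (ℕ; zero; suc; _+_; _≤_; _%_; s≤s; z≤n)
open import Data.Nat.Properties using (+-suc; ≤-trans; +-monoʳ-≤; m≤n⇒m≤1+n; ≡ᵇ⇒≡; m≤n⇒m<n∨m≡n; suc-injective)
open import Data.Nat.DivMod using (m<n⇒m%n≡m; n%n≡0)
open import Data.Fin using (Fin; zero; suc; toℕ; fromℕ; lift; _≟_)
open import Data.Fin.Properties using (toℕ<n; toℕ-fromℕ; toℕ-injective; lift-injective) renaming (any? to ∃?; suc-injective to fsuc-injective)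
open import Data.Bool using (true; false)
open import Data.Bool.Properties using (¬-not; T-≡; T-∨)
open import Data.List using (List; []; _∷_; length)
open import Data.List.Relation.Unary.Any using (here; there; any?)
open import Data.List.Membership.Propositional using (_∈_; _∉_)
open import Data.Product using (Σ; _×_; _,_)
open import Data.Sum using (_⊎_; inj₁; inj₂)
open import Data.Empty using (⊥-elim)
open import Function using (_∘_; case_of_)
open import Function.Bundles using (Equivalence)
open import Function.Definitions using (Injective)
open import Relation.Binary.PropositionalEquality using (_≡_; _≢_; refl; cong; subst; trans) renaming (sym to ≡-sym)
open import Relation.Nullary using (yes; no)

predecessors : ∀ {n} → List (Fin (suc n)) → List (Fin n)
predecessors []         = []
predecessors (zero ∷ xs)  = predecessors xs
predecessors (suc x ∷ xs) = x ∷ predecessors xs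

length-predecessors : ∀ {n} (xs : List (Fin (suc n))) → length (predecessors xs) ≤ length xs
length-predecessors []           = z≤n
length-predecessors (zero ∷ xs)  = m≤n⇒m≤1+n (length-predecessors xs)
length-predecessors (suc x ∷ xs) = s≤s (length-predecessors xs)

length-predecessors-< : ∀ {n} {xs : List (Fin (suc n))} → zero ∈ xs →
  suc (length (predecessors xs)) ≤ length xs
length-predecessors-< {xs = zero ∷ xs}  (here refl) = s≤s (length-predecessors xs)
length-predecessors-< {xs = zero ∷ xs}  (there z∈) = m≤n⇒m≤1+n (length-predecessors-< z∈)
length-predecessors-< {xs = suc _ ∷ xs} (there z∈) = s≤s (length-predecessors-< z∈)

∈-predecessors : ∀ {n} {x : Fin n} {xs : List (Fin (suc n))} → suc x ∈ xs → x ∈ predecessors xs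
∈-predecessors {xs = zero ∷ xs}  (there x∈) = ∈-predecessors x∈
∈-predecessors {xs = suc _ ∷ xs} (here refl) = here refl
∈-predecessors {xs = suc _ ∷ xs} (there x∈) = there (∈-predecessors x∈)

injection-avoiding : ∀ {n} p (B : List (Fin n)) → p + length B ≤ n →
  Σ (Fin p → Fin n) λ w → Injective _≡_ _≡_ w × (∀ i → w i ∉ B)
injection-avoiding zero B _ = (λ ()) , (λ { {()} }) , (λ ())
injection-avoiding {suc n} (suc p) B (s≤s p+B≤n) with any? (zero ≟_) B
... | no 0∉B =
  let (w , w-inj , w∉) = injection-avoiding p (predecessors B)
                           (≤-trans (+-monoʳ-≤ p (length-predecessors B)) p+B≤n)
  in lift 1 w , lift-injective w w-inj 1 , λ { zero → 0∉B ; (suc i) → w∉ i ∘ ∈-predecessors }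
... | yes 0∈B =
  let (w , w-inj , w∉) = injection-avoiding (suc p) (predecessors B)
                           (subst (_≤ n) (+-suc p _)
                             (≤-trans (+-monoʳ-≤ p (length-predecessors-< 0∈B)) p+B≤n))
  in suc ∘ w , w-inj ∘ fsuc-injective , λ i → w∉ i ∘ ∈-predecessors

cycleAdj-sound : ∀ K (i j : Fin (suc K)) → cycleAdj K i j ≡ true →
  toℕ j ≡ suc (toℕ i) % suc K ⊎ toℕ i ≡ suc (toℕ j) % suc K
cycleAdj-sound K i j adj-ij with Equivalence.to T-∨ (Equivalence.from T-≡ adj-ij)
... | inj₁ t = inj₁ (≡ᵇ⇒≡ _ _ t)
... | inj₂ t = inj₂ (≡ᵇ⇒≡ _ _ t)

suc-toℕ-% : ∀ K (j : Fin (suc K)) → suc (toℕ j) % suc K ≡ suc (toℕ j) ⊎ toℕ j ≡ K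
suc-toℕ-% K j with m≤n⇒m<n∨m≡n (toℕ<n j)
... | inj₁ j<K = inj₁ (m<n⇒m%n≡m j<K)
... | inj₂ j≡K = inj₂ (suc-injective j≡K)

cycleAdj-zero : ∀ K (j : Fin (suc K)) → cycleAdj K zero j ≡ true →
  toℕ j ≡ 1 % suc K ⊎ toℕ j ≡ K
cycleAdj-zero K j adj-0j with cycleAdj-sound K zero j adj-0j
... | inj₁ j≡1 = inj₁ j≡1
... | inj₂ 0≡sj with suc-toℕ-% K j
...   | inj₁ sj≡sj = case trans 0≡sj sj≡sj of λ ()
...   | inj₂ j≡K = inj₂ j≡K

cycleAdj-suc : ∀ K (i : Fin K) (j : Fin (suc K)) → cycleAdj K (suc i) j ≡ true →
  toℕ j ≡ suc (suc (toℕ i)) % suc K ⊎ toℕ j ≡ toℕ i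
cycleAdj-suc K i j adj-ij with cycleAdj-sound K (suc i) j adj-ij
... | inj₁ j≡i+2 = inj₁ j≡i+2
... | inj₂ i+1≡sj with suc-toℕ-% K j
...   | inj₁ sj≡sj = inj₂ (suc-injective (≡-sym (trans i+1≡sj sj≡sj)))
...   | inj₂ j≡K   = case trans i+1≡sj (trans (cong (λ k → suc k % suc K) j≡K) (n%n≡0 (suc K))) of λ ()

complement-nonadjacent : ∀ {n} (G : SimpleGraph n) {x y} → x ≢ y →
  adj (complement G) x y ≡ false → adj G x y ≡ true
complement-nonadjacent G {x} {y} x≢y with adj G x y | x ≟ y
... | true  | _      = λ _ → refl
... | false | yes eq = ⊥-elim (x≢y eq)
... | false | no _   = λ ()

cycleComponent-adj-outside : ∀ {n K} (H : SimpleGraph n) (c : Fin (suc K) → Fin n) →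
  (∀ i j → adj H (c i) (c j) ≡ cycleAdj K i j) →
  (∀ i v → (∀ j → v ≢ c j) → adj H (c i) v ≡ false) →
  ∀ i (B : List (Fin n)) → (∀ j → cycleAdj K i j ≡ true → c j ∈ B) →
  ∀ x → x ∉ B → adj H (c i) x ≡ false
cycleComponent-adj-outside H c c-adj c-closed i B nbrs⊆B x x∉B with ∃? (λ j → x ≟ c j)
... | yes (j , refl) = trans (c-adj i j) (¬-not (x∉B ∘ nbrs⊆B j))
... | no x∉c         = c-closed i x (λ j x≡cj → x∉c (j , x≡cj))

book-from-common-neighbours : ∀ {n} (G : SimpleGraph n) p {u v} (B : List (Fin n)) →
  u ≢ v → adj G u v ≡ true → u ∈ B → v ∈ B →
  (∀ {x} → x ∉ B → adj G u x ≡ true × adj G v x ≡ true) →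
  p + length B ≤ n → ContainsBook G p
book-from-common-neighbours G p {u} {v} B u≢v adj-uv u∈B v∈B common p+B≤n =
  let (w , w-inj , w∉B) = injection-avoiding p B p+B≤n in
  u , v , w , u≢v , adj-uv , w-inj ,
  λ i → (λ wi≡u → w∉B i (subst (_∈ B) (≡-sym wi≡u) u∈B))
      , (λ wi≡v → w∉B i (subst (_∈ B) (≡-sym wi≡v) v∈B))
      , common (w∉B i)

lemma2 : (n p : ℕ) → 1 ≤ p → p + 5 ≤ n → (G : SimpleGraph n) →
    Σ ℕ (λ m → HasCycleComponent (complement G) m) → ContainsBook G p
lemma2 n p _ p+5≤n G (m , c , c-inj , c-adj , c-closed) =
  book-from-common-neighbours G p B u≢v (complement-nonadjacent G u≢v (c-adj zero two))
    u∈B v∈B common-neighbour p+5≤n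
  where
    K = 3 + m
    one two three : Fin (suc K)
    one = suc zero
    two = suc (suc zero)
    three = suc (suc (suc zero))
    u = c zero
    v = c two
    B : List (Fin n)
    B = c (fromℕ K) ∷ u ∷ c one ∷ v ∷ c three ∷ []

    u∈B : u ∈ B
    u∈B = there (here refl)

    v∈B : v ∈ B
    v∈B = there (there (there (here refl)))

    u≢v : u ≢ v
    u≢v u≡v with c-inj u≡v
    ... | ()

    nbrs-u⊆B : ∀ j → cycleAdj K zero j ≡ true → c j ∈ B
    nbrs-u⊆B j adj-0j with cycleAdj-zero K j adj-0j
    ... | inj₁ j≡1 = there (there (here (cong c (toℕ-injective j≡1))))
    ... | inj₂ j≡K = here (cong c (toℕ-injective (trans j≡K (≡-sym (toℕ-fromℕ K)))))

    nbrs-v⊆B : ∀ j → cycleAdj K two j ≡ true → c j ∈ B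
    nbrs-v⊆B j adj-2j with cycleAdj-suc K (suc zero) j adj-2j
    ... | inj₁ j≡3 = there (there (there (there (here (cong c (toℕ-injective j≡3))))))
    ... | inj₂ j≡1 = there (there (here (cong c (toℕ-injective j≡1))))

    outside-adj : ∀ i → (∀ j → cycleAdj K i j ≡ true → c j ∈ B) → c i ∈ B →
      ∀ {x} → x ∉ B → adj G (c i) x ≡ true
    outside-adj i nbrs⊆B ci∈B {x} x∉B =
      complement-nonadjacent G (λ ci≡x → x∉B (subst (_∈ B) ci≡x ci∈B))
        (cycleComponent-adj-outside (complement G) c c-adj c-closed i B nbrs⊆B x x∉B)

    common-neighbour : ∀ {x} → x ∉ B → adj G u x ≡ true × adj G v x ≡ true
    common-neighbour x∉B = outside-adj zero nbrs-u⊆B u∈B x∉B , outside-adj two nbrs-v⊆B v∈B x∉B
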